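{- Let $\preceq$ be an entrenchment relation satisfying Left Disjunction, and let $\mathrel{|\!\sim}=N(\preceq)$, i.e. $\alpha\mathrel{|\!\sim}\beta$ iff $\neg\beta\preceq\neg\alpha$. Then $\mathrel{|\!\sim}$ is a nonmonotonic consequence relation such that for all $\alpha,\beta\in\mathcal{L}$, $\alpha\mathrel{|\!\sim}\beta$ iff $\alpha\mathrel{|\!\sim_\preceq}\beta$. Moreover, if $\preceq$ satisfies Bounded Cut, Bounded Right Monotonicity, Acyclicity and Right Conjunction, then $\mathrel{|\!\sim_\preceq}$ satisfies Cut, Cautious Monotonicity, Loop and Or, respectively.
   Context: $\mathcal{L}$ is the set of formulas of a propositional language closed under $\lor,\land,\neg,\to$. $\vdash\subseteq 2^{\mathcal{L}}\times\mathcal{L}$ is a fixed consequence relation including classical propositional logic, compact, satisfying the deduction theorem and disjunction in premises; $\alpha\vdash\beta$ means $\{\alpha\}\vdash\beta$; $\mathrm{Cn}(X)=\{\beta:X\vdash\beta\}$, $\mathrm{Cn}(X,\alpha)=\mathrm{Cn}(X\cup\{\alpha\})$. An entrenchment relation is a binary relation $\preceq$ on $\mathcal{L}$ such that for all $\alpha,\beta,\gamma$: $\alpha\preceq\alpha$; $\alpha\vdash\beta$ and $\beta\preceq\gamma$ imply $\alpha\preceq\gamma$; if $\alpha\vdash\beta$ and $\beta\vdash\alpha$ then $\gamma\preceq\alpha$ iff $\gamma\preceq\beta$. Properties of $\preceq$ (for all formulas): Left Disjunction: $\beta\preceq\alpha$, $\gamma\preceq\alpha$ imply $\beta\lor\gamma\preceq\alpha$.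 Bounded Cut: $\gamma\preceq\alpha\lor\beta$, $\beta\preceq\alpha$ imply $\gamma\preceq\alpha$. Bounded Right Monotonicity: $\gamma\preceq\alpha$, $\beta\preceq\alpha$ imply $\gamma\preceq\alpha\lor\beta$. Acyclicity: for all $n\ge1$, $\alpha_0\preceq\alpha_n$, $\alpha_n\preceq\alpha_{n-1}$, ..., $\alpha_1\preceq\alpha_0$ imply $\alpha_n\preceq\alpha_0$. Right Conjunction: $\gamma\preceq\alpha$, $\gamma\preceq\beta$ imply $\gamma\preceq\alpha\land\beta$. Maxiconsistent inference: $\mathrm{Coh}(\alpha)=\{\beta:\beta\not\preceq\neg\alpha\}$; $\mathcal{B}(\alpha)$ = deductively closed $U$ with $U\subseteq\mathrm{Coh}(\alpha)$; $\mathcal{B}_{\max}(\alpha)$ = those $U\in\mathcal{B}(\alpha)$ with no deductively closed $U'\supsetneq U$ in $\mathcal{B}(\alpha)$; $E(\alpha)=\bigcap\{\mathrm{Cn}(U,\alpha):U\in\mathcal{B}_{\max}(\alpha)\}$ (empty intersection $=\mathcal{L}$); $\alpha\mathrel{|\!\sim_\preceq}\beta$ iff $\beta\in E(\alpha)$. A nonmonotonic consequence relation is a binary relation $\mathrel{|\!\sim}$ on $\mathcal{L}$ satisfying Supraclassicality ($\alpha\vdash\beta\Rightarrow\alpha\mathrel{|\!\sim}\beta$), Left Logical Equivalence ($\alpha\vdash\beta$, $\beta\vdash\alpha$, $\alpha\mathrel{|\!\sim}\gamma\Rightarrow\beta\mathrel{|\!\sim}\gamma$), Right Weakening ($\alpha\mathrel{|\!\sim}\beta$,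 $\beta\vdash\gamma\Rightarrow\alpha\mathrel{|\!\sim}\gamma$) and And ($\alpha\mathrel{|\!\sim}\beta$, $\alpha\mathrel{|\!\sim}\gamma\Rightarrow\alpha\mathrel{|\!\sim}\beta\land\gamma$). Rules: Cut: $\alpha\mathrel{|\!\sim}\beta$, $\alpha\land\beta\mathrel{|\!\sim}\gamma\Rightarrow\alpha\mathrel{|\!\sim}\gamma$. Cautious Monotonicity: $\alpha\mathrel{|\!\sim}\beta$, $\alpha\mathrel{|\!\sim}\gamma\Rightarrow\alpha\land\beta\mathrel{|\!\sim}\gamma$. Loop: for $n\ge1$, $\alpha_0\mathrel{|\!\sim}\alpha_1,\dots,\alpha_{n-1}\mathrel{|\!\sim}\alpha_n$, $\alpha_n\mathrel{|\!\sim}\alpha_0\Rightarrow\alpha_0\mathrel{|\!\sim}\alpha_n$. Or: $\alpha\mathrel{|\!\sim}\gamma$, $\beta\mathrel{|\!\sim}\gamma\Rightarrow\alpha\lor\beta\mathrel{|\!\sim}\gamma$. -}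

module Defs where

open import Level using (Level)
open import Data.Bool using (Bool; true; false; _∧_; _∨_; not)
open import Data.Nat using (ℕ; zero; suc; _<_)
open import Data.List using (List)
open import Data.List.Membership.Propositional using (_∈_)
open import Data.List.Relation.Unary.All using (All)
open import Data.Product using (Σ; _×_; _,_)
open import Data.Sum using (_⊎_)
open import Relation.Nullary using (¬_)
open import Relation.Binary.PropositionalEquality using (_≡_)

-- Classical meta-theory (the paper works in ZFC).  These are used as
-- explicit hypotheses of the main theorem.

ExcludedMiddle : Set₁
ExcludedMiddle = (P : Set) → P ⊎ ¬ P

Zorn : Set₁
Zorn =
  (A : Set) (_≤_ : A → A → Set) (P : A → Set) →
  (∀ a → a ≤ a) →
  (∀ a b c → a ≤ b → b ≤ c → a ≤ c) →
  ((C : A → Set) →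
     (∀ x → C x → P x) →
     (∀ x y → C x → C y → (x ≤ y) ⊎ (y ≤ x)) →
     Σ A C →
     Σ A (λ u → P u × (∀ x → C x → x ≤ u))) →
  ∀ a → P a →
  Σ A (λ m → P m × (a ≤ m) × (∀ b → P b → m ≤ b → b ≤ m))

infixr 6 _∧ᶠ_
infixr 5 _∨ᶠ_
infixr 4 _⇒ᶠ_

data Form (Atom : Set) : Set where
  var   : Atom → Form Atom
  _∨ᶠ_  : Form Atom → Form Atom → Form Atom
  _∧ᶠ_  : Form Atom → Form Atom → Form Atom
  ¬ᶠ_   : Form Atom → Form Atom
  _⇒ᶠ_  : Form Atom → Form Atom → Form Atom

module _ {Atom : Set} where

  FSet : Set₁
  FSet = Form Atom → Set

  _⊆_ : FSet → FSet → Set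
  X ⊆ Y = ∀ x → X x → Y x

  _∪_ : FSet → FSet → FSet
  (X ∪ Y) x = X x ⊎ Y x

  ⟦_⟧ : Form Atom → FSet
  ⟦ α ⟧ x = x ≡ α

  listSet : List (Form Atom) → FSet
  listSet xs x = x ∈ xs

  eval : (Atom → Bool) → Form Atom → Bool
  eval v (var p)  = v p
  eval v (a ∨ᶠ b) = eval v a ∨ eval v b
  eval v (a ∧ᶠ b) = eval v a ∧ eval v b
  eval v (¬ᶠ a)   = not (eval v a)
  eval v (a ⇒ᶠ b) = not (eval v a) ∨ eval v b

  _⊨_ : FSet → Form Atom → Set
  X ⊨ β = (v : Atom → Bool) → (∀ x → X x → eval v x ≡ true) → eval v β ≡ true

  record ConsequenceRelation : Set₁ where
    field
      _⊢_ : FSet → Form Atom → Set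
      reflexivity  : ∀ {X α} → X α → X ⊢ α
      monotonicity : ∀ {X Y α} → X ⊆ Y → X ⊢ α → Y ⊢ α
      cut          : ∀ {X Y α} → (∀ y → Y y → X ⊢ y) → (X ∪ Y) ⊢ α → X ⊢ α
      supraclassical : ∀ {X α} → X ⊨ α → X ⊢ α
      compact : ∀ {X α} → X ⊢ α →
                Σ (List (Form Atom)) (λ xs → All X xs × (listSet xs ⊢ α))
      deduction   : ∀ {X α β} → (X ∪ ⟦ α ⟧) ⊢ β → X ⊢ (α ⇒ᶠ β)
      deduction⁻¹ : ∀ {X α β} → X ⊢ (α ⇒ᶠ β) → (X ∪ ⟦ α ⟧) ⊢ β
      disjPremises : ∀ {X α β γ} → (X ∪ ⟦ α ⟧) ⊢ γ → (X ∪ ⟦ β ⟧) ⊢ γ →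
                     (X ∪ ⟦ α ∨ᶠ β ⟧) ⊢ γ

module _ {Atom : Set} (CR : ConsequenceRelation {Atom}) where
  open ConsequenceRelation CR

  L : Set
  L = Form Atom

  _⊢₁_ : L → L → Set
  α ⊢₁ β = ⟦ α ⟧ ⊢ β

  Cn : FSet → FSet
  Cn X β = X ⊢ β

  Cn+ : FSet → L → FSet
  Cn+ X α = Cn (X ∪ ⟦ α ⟧)

  DeductivelyClosed : FSet → Set
  DeductivelyClosed U = Cn U ⊆ U

  record IsEntrenchment (_≼_ : L → L → Set) : Set where
    field
      ≼-refl  : ∀ α → α ≼ α
      ≼-mono  : ∀ {α β γ} → α ⊢₁ β → β ≼ γ → α ≼ γ
      ≼-equiv : ∀ {α β γ} → α ⊢₁ β → β ⊢₁ α → (γ ≼ α → γ ≼ β) × (γ ≼ β → γ ≼ α)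

  module _ (_≼_ : L → L → Set) where

    LeftDisjunction : Set
    LeftDisjunction = ∀ {α β γ} → β ≼ α → γ ≼ α → (β ∨ᶠ γ) ≼ α

    BoundedCut : Set
    BoundedCut = ∀ {α β γ} → γ ≼ (α ∨ᶠ β) → β ≼ α → γ ≼ α

    BoundedRightMonotonicity : Set
    BoundedRightMonotonicity = ∀ {α β γ} → γ ≼ α → β ≼ α → γ ≼ (α ∨ᶠ β)

    -- for all n ≥ 1 (written n = suc m) and formulas α₀ … αₙ (a sequence a):
    -- α₀ ≼ αₙ, αᵢ₊₁ ≼ αᵢ (i < n)  imply  αₙ ≼ α₀
    Acyclicity : Set
    Acyclicity = ∀ (m : ℕ) (a : ℕ → L) →
      a 0 ≼ a (suc m) → (∀ i → i < suc m → a (suc i) ≼ a i) → a (suc m) ≼ a 0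

    RightConjunction : Set
    RightConjunction = ∀ {α β γ} → γ ≼ α → γ ≼ β → γ ≼ (α ∧ᶠ β)

    N : L → L → Set
    N α β = (¬ᶠ β) ≼ (¬ᶠ α)

    Coh : L → FSet
    Coh α β = ¬ (β ≼ (¬ᶠ α))

    InB : L → FSet → Set
    InB α U = DeductivelyClosed U × (U ⊆ Coh α)

    InBmax : L → FSet → Set₁
    InBmax α U = InB α U ×
      ¬ Σ FSet (λ U′ → InB α U′ × (U ⊆ U′) × ¬ (U′ ⊆ U))

    E : L → Form Atom → Set₁
    E α β = ∀ U → InBmax α U → Cn+ U α β

    MaxInf : L → L → Set₁
    MaxInf α β = E α β

  module _ {ℓ : Level} (_|~_ : L → L → Set ℓ) where

    IsNMCR : Set ℓ
    IsNMCR =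
      (∀ {α β} → α ⊢₁ β → α |~ β) ×
      (∀ {α β γ} → α ⊢₁ β → β ⊢₁ α → α |~ γ → β |~ γ) ×
      (∀ {α β γ} → α |~ β → β ⊢₁ γ → α |~ γ) ×
      (∀ {α β γ} → α |~ β → α |~ γ → α |~ (β ∧ᶠ γ))

    CutRule : Set ℓ
    CutRule = ∀ {α β γ} → α |~ β → (α ∧ᶠ β) |~ γ → α |~ γ

    CautiousMonotonicity : Set ℓ
    CautiousMonotonicity = ∀ {α β γ} → α |~ β → α |~ γ → (α ∧ᶠ β) |~ γ

    -- for n ≥ 1 (n = suc m): α₀ |~ α₁, …, αₙ₋₁ |~ αₙ, αₙ |~ α₀ ⇒ α₀ |~ αₙ
    LoopRule : Set ℓ
    LoopRule = ∀ (m : ℕ) (a : ℕ → L) →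
      (∀ i → i < suc m → a i |~ a (suc i)) → a (suc m) |~ a 0 → a 0 |~ a (suc m)

    OrRule : Set ℓ
    OrRule = ∀ {α β γ} → α |~ γ → β |~ γ → (α ∨ᶠ β) |~ γ

{-# OPTIONS --safe #-}
-- If ¬β ≼ ¬α, then by Left Disjunction adding α ⇒ β to an α-coherent theory
-- keeps it α-coherent, so every maximal one already contains α ⇒ β and hence
-- β ∈ Cn(U, α). If ¬β ⋠ ¬α, then Cn(¬β) is α-coherent and extends, by Zorn's
-- lemma, to a maximal U; β ∈ Cn(U, α) would make U prove ¬α, which is never
-- coherent because ¬α ≼ ¬α. So maxiconsistent inference is N(≼), and under
-- α ↦ ¬α and De Morgan each of the four rules of |~ is the corresponding
-- property of ≼.
module Submission where

open import Defs
open import Data.Bool using (Bool; true; false; not; T) renaming (_∧_ to _&&_; _∨_ to _||_)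
open import Data.Bool.Properties using (∨-∧-booleanAlgebra; ∧-conicalʳ; not-involutive)
open import Algebra.Lattice.Properties.BooleanAlgebra ∨-∧-booleanAlgebra using (deMorgan₁; deMorgan₂)
open import Data.Empty using (⊥)
open import Data.List using (List; []; _∷_)
open import Data.List.Relation.Unary.All as All using (All; []; _∷_)
open import Data.List.Relation.Unary.Any using (here; there)
open import Data.Product using (Σ; _×_; _,_; proj₁; proj₂)
open import Data.Sum using (_⊎_; inj₁; inj₂)
open import Function using (_∘_; id)
open import Relation.Nullary using (¬_; Dec)
open import Relation.Nullary.Decidable using (isYes; fromSum; toWitness; fromWitness; decidable-stable)
open import Relation.Binary.PropositionalEquality using (_≡_; refl; sym; trans; cong)

modus-tollens : ∀ a b → not a || b ≡ true → not b ≡ true → not a ≡ true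
modus-tollens false _     _  _  = refl
modus-tollens true  true  _  ()
modus-tollens true  false () _

module Classical {Atom : Set} (CR : ConsequenceRelation {Atom}) where
  open ConsequenceRelation CR

  _≗_ : L CR → L CR → Set
  α ≗ β = ∀ v → eval v α ≡ eval v β

  ⊨₁⇒⊢₁ : ∀ {α β} → (∀ v → eval v α ≡ true → eval v β ≡ true) → _⊢₁_ CR α β
  ⊨₁⇒⊢₁ {α} α⊨β = supraclassical λ v v⊨α → α⊨β v (v⊨α α refl)

  ≗⇒⊢₁ : ∀ {α β} → α ≗ β → _⊢₁_ CR α β
  ≗⇒⊢₁ α≗β = ⊨₁⇒⊢₁ λ v → trans (sym (α≗β v))

  ⊢-combine : ∀ {X φ ψ θ} → X ⊢ φ → X ⊢ ψ →
              (∀ v → eval v φ ≡ true → eval v ψ ≡ true → eval v θ ≡ true) → X ⊢ θ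
  ⊢-combine {X} {φ} {ψ} X⊢φ X⊢ψ φ,ψ⊨θ =
    cut premises (supraclassical λ v v⊨ →
      φ,ψ⊨θ v (v⊨ φ (inj₂ (inj₁ refl))) (v⊨ ψ (inj₂ (inj₂ refl))))
    where
      premises : ∀ y → y ≡ φ ⊎ y ≡ ψ → X ⊢ y
      premises _ (inj₁ refl) = X⊢φ
      premises _ (inj₂ refl) = X⊢ψ

  contraposition : ∀ {α β} → _⊢₁_ CR α β → _⊢₁_ CR (¬ᶠ β) (¬ᶠ α)
  contraposition {α} {β} α⊢β =
    ⊢-combine (deduction (monotonicity (λ _ → inj₂) α⊢β)) (reflexivity refl)
              (λ v → modus-tollens (eval v α) (eval v β))

  Cn-closed : (X : FSet) → DeductivelyClosed CR (Cn CR X)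
  Cn-closed X δ Cn[X]⊢δ = cut (λ _ → id) (monotonicity (λ _ → inj₂) Cn[X]⊢δ)

  ¬∧≗¬∨¬ : ∀ α β → (¬ᶠ (α ∧ᶠ β)) ≗ (¬ᶠ α ∨ᶠ ¬ᶠ β)
  ¬∧≗¬∨¬ α β v = deMorgan₁ (eval v α) (eval v β)

  ¬∨≗¬∧¬ : ∀ α β → (¬ᶠ (α ∨ᶠ β)) ≗ (¬ᶠ α ∧ᶠ ¬ᶠ β)
  ¬∨≗¬∧¬ α β v = deMorgan₂ (eval v α) (eval v β)

  ¬⇒≗∧¬ : ∀ α β → (¬ᶠ (α ⇒ᶠ β)) ≗ (α ∧ᶠ ¬ᶠ β)
  ¬⇒≗∧¬ α β v = trans (deMorgan₂ (not (eval v α)) (eval v β))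
                      (cong (_&& not (eval v β)) (not-involutive (eval v α)))

-- Zorn's lemma quantifies over a Set while FSet is large, so sets of
-- formulas are coded by their characteristic functions.
module Coding (em : ExcludedMiddle) (Atom : Set) where

  dec : (P : Set) → Dec P
  dec P = fromSum (em P)

  Code : Set
  Code = Form Atom → Bool

  ⟪_⟫ : Code → FSet
  ⟪ u ⟫ x = T (u x)

  _≤_ : Code → Code → Set
  u ≤ w = ⟪ u ⟫ ⊆ ⟪ w ⟫

  χ : FSet → Code
  χ X x = isYes (dec (X x))

  χ-sound : ∀ X → ⟪ χ X ⟫ ⊆ X
  χ-sound X x = toWitness {a? = dec (X x)}

  χ-complete : ∀ X → X ⊆ ⟪ χ X ⟫
  χ-complete X x = fromWitness {a? = dec (X x)}

  ⋃ : (Code → Set) → FSet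
  ⋃ C x = Σ Code λ u → C u × T (u x)

  chain-covers : ∀ {C} → (∀ u w → C u → C w → u ≤ w ⊎ w ≤ u) → Σ Code C →
                 (xs : List (Form Atom)) → All (⋃ C) xs → Σ Code λ u → C u × listSet xs ⊆ ⟪ u ⟫
  chain-covers total (u , u∈C) [] [] = u , u∈C , λ _ ()
  chain-covers total c₀ (x ∷ xs) ((u , u∈C , x∈u) ∷ xs⊆⋃)
    with chain-covers total c₀ xs xs⊆⋃
  ... | w , w∈C , xs⊆w with total u w u∈C w∈C
  ... | inj₁ u≤w = w , w∈C , λ { _ (here refl) → u≤w _ x∈u ; y (there y∈xs) → xs⊆w y y∈xs }
  ... | inj₂ w≤u = u , u∈C , λ { _ (here refl) → x∈u ; y (there y∈xs) → w≤u y (xs⊆w y y∈xs) }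

module Entrenchment {Atom : Set} (CR : ConsequenceRelation {Atom})
  (_≼_ : L CR → L CR → Set) (isE : IsEntrenchment CR _≼_) where
  open ConsequenceRelation CR
  open IsEntrenchment isE
  open Classical CR

  ≼-respʳ-≗ : ∀ {α β γ} → α ≗ β → γ ≼ α → γ ≼ β
  ≼-respʳ-≗ α≗β = proj₁ (≼-equiv (≗⇒⊢₁ α≗β) (≗⇒⊢₁ (sym ∘ α≗β)))

  N-isNMCR : LeftDisjunction CR _≼_ → IsNMCR CR (N CR _≼_)
  N-isNMCR ld =
      (λ α⊢β → ≼-mono (contraposition α⊢β) (≼-refl _))
    , (λ α⊢β β⊢α → proj₁ (≼-equiv (contraposition β⊢α) (contraposition α⊢β)))
    , (λ α|~β β⊢γ → ≼-mono (contraposition β⊢γ) α|~β)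
    , (λ {_} {β} {γ} α|~β α|~γ → ≼-mono (≗⇒⊢₁ (¬∧≗¬∨¬ β γ)) (ld α|~β α|~γ))

  N-cut : BoundedCut CR _≼_ → CutRule CR (N CR _≼_)
  N-cut bc {α} {β} α|~β α∧β|~γ = bc (≼-respʳ-≗ (¬∧≗¬∨¬ α β) α∧β|~γ) α|~β

  N-cautiousMonotonicity : BoundedRightMonotonicity CR _≼_ → CautiousMonotonicity CR (N CR _≼_)
  N-cautiousMonotonicity brm {α} {β} α|~β α|~γ =
    ≼-respʳ-≗ (sym ∘ ¬∧≗¬∨¬ α β) (brm α|~γ α|~β)

  N-loop : Acyclicity CR _≼_ → LoopRule CR (N CR _≼_)
  N-loop ac m a steps back = ac m (¬ᶠ_ ∘ a) back steps

  N-or : RightConjunction CR _≼_ → OrRule CR (N CR _≼_)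
  N-or rc {α} {β} α|~γ β|~γ = ≼-respʳ-≗ (sym ∘ ¬∨≗¬∧¬ α β) (rc α|~γ β|~γ)

  module _ (em : ExcludedMiddle) where
    open Coding em Atom

    InBmax-absorbs : ∀ {α φ U} → InBmax CR _≼_ α U →
                     (∀ δ → δ ≼ (¬ᶠ α) → (φ ⇒ᶠ δ) ≼ (¬ᶠ α)) → U φ
    InBmax-absorbs {α} {φ} {U} ((U-closed , U-coh) , U-max) ⇒-≼ =
      decidable-stable (dec (U φ)) λ φ∉U →
        U-max ( Cn+ CR U φ , (Cn-closed _ , coherent)
              , (λ _ → reflexivity ∘ inj₁)
              , (λ U,φ⊆U → φ∉U (U,φ⊆U φ (reflexivity (inj₂ refl)))))
      where
        coherent : Cn+ CR U φ ⊆ Coh CR _≼_ α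
        coherent δ U,φ⊢δ δ≼¬α = U-coh _ (U-closed _ (deduction U,φ⊢δ)) (⇒-≼ δ δ≼¬α)

    N⇒MaxInf : LeftDisjunction CR _≼_ → ∀ {α β} → N CR _≼_ α β → MaxInf CR _≼_ α β
    N⇒MaxInf ld {α} {β} ¬β≼¬α U U-max = deduction⁻¹ (reflexivity (InBmax-absorbs U-max ⇒-≼))
      where
        α∧¬β≼¬α : (α ∧ᶠ ¬ᶠ β) ≼ (¬ᶠ α)
        α∧¬β≼¬α = ≼-mono (⊨₁⇒⊢₁ λ v → ∧-conicalʳ (eval v α) _) ¬β≼¬α
        ⇒-≼ : ∀ δ → δ ≼ (¬ᶠ α) → ((α ⇒ᶠ β) ⇒ᶠ δ) ≼ (¬ᶠ α)
        ⇒-≼ δ δ≼¬α =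
          ≼-mono (≗⇒⊢₁ λ v → cong (_|| eval v δ) (¬⇒≗∧¬ α β v)) (ld α∧¬β≼¬α δ≼¬α)

    module _ (α : L CR) where

      Admissible : Code → Set
      Admissible u = InB CR _≼_ α ⟪ u ⟫

      InB⇒Admissible : ∀ {X} → InB CR _≼_ α X → Admissible (χ X)
      InB⇒Admissible {X} (X-closed , X-coh) =
          (λ δ ⊢δ → χ-complete X δ (X-closed δ (monotonicity (χ-sound X) ⊢δ)))
        , (λ x → X-coh x ∘ χ-sound X x)

      chain-bounded : (C : Code → Set) → (∀ u → C u → Admissible u) →
                      (∀ u w → C u → C w → u ≤ w ⊎ w ≤ u) → Σ Code C →
                      Σ Code λ b → Admissible b × (∀ u → C u → u ≤ b)
      chain-bounded C admissible total c₀ = χ (⋃ C) , (closed , coherent) , upper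
        where
          upper : ∀ u → C u → u ≤ χ (⋃ C)
          upper u u∈C x x∈u = χ-complete (⋃ C) x (u , u∈C , x∈u)
          coherent : ⟪ χ (⋃ C) ⟫ ⊆ Coh CR _≼_ α
          coherent x x∈⋃ with χ-sound (⋃ C) x x∈⋃
          ... | u , u∈C , x∈u = proj₂ (admissible u u∈C) x x∈u
          closed : DeductivelyClosed CR ⟪ χ (⋃ C) ⟫
          closed δ ⊢δ with compact ⊢δ
          ... | xs , xs⊆⋃ , xs⊢δ with chain-covers total c₀ xs (All.map (χ-sound (⋃ C) _) xs⊆⋃)
          ... | u , u∈C , xs⊆u =
            χ-complete (⋃ C) δ (u , u∈C , proj₁ (admissible u u∈C) δ (monotonicity xs⊆u xs⊢δ))

    InBmax-above : Zorn → ∀ {α V} → InB CR _≼_ α V → Σ FSet λ U → InBmax CR _≼_ α U × V ⊆ U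
    InBmax-above zorn {α} {V} V∈B
      with zorn Code _≤_ (Admissible α) (λ _ _ → id) (λ _ _ _ u≤v v≤w x → v≤w x ∘ u≤v x)
                (chain-bounded α) (χ V) (InB⇒Admissible α V∈B)
    ... | m , m-adm , V≤m , m-max =
        ⟪ m ⟫
      , (m-adm , λ (U , U∈B , m⊆U , U⊈m) → U⊈m λ x x∈U →
           m-max (χ U) (InB⇒Admissible α U∈B) (λ y → χ-complete U y ∘ m⊆U y)
                 x (χ-complete U x x∈U))
      , (λ x → V≤m x ∘ χ-complete V x)

    MaxInf⇒N : Zorn → ∀ {α β} → MaxInf CR _≼_ α β → N CR _≼_ α β
    MaxInf⇒N zorn {α} {β} α|~β = decidable-stable (dec (N CR _≼_ α β)) refute
      where
        Cn¬β-coherent : ¬ N CR _≼_ α β → Cn CR ⟦ ¬ᶠ β ⟧ ⊆ Coh CR _≼_ α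
        Cn¬β-coherent ¬β⋠¬α δ ¬β⊢δ δ≼¬α = ¬β⋠¬α (≼-mono ¬β⊢δ δ≼¬α)
        refute : ¬ N CR _≼_ α β → ⊥
        refute ¬β⋠¬α with InBmax-above zorn (Cn-closed ⟦ ¬ᶠ β ⟧ , Cn¬β-coherent ¬β⋠¬α)
        ... | U , U-max@((U-closed , U-coh) , _) , Cn¬β⊆U =
          U-coh (¬ᶠ α) (U-closed _ U⊢¬α) (≼-refl _)
          where
            U⊢¬α : U ⊢ (¬ᶠ α)
            U⊢¬α = ⊢-combine (deduction (α|~β U U-max)) (reflexivity (Cn¬β⊆U _ (reflexivity refl)))
                             (λ v → modus-tollens (eval v α) (eval v β))

mainTheorem13 : ExcludedMiddle → Zorn →
    (Atom : Set) (CR : ConsequenceRelation {Atom}) (_≼_ : L CR → L CR → Set) →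
    IsEntrenchment CR _≼_ → LeftDisjunction CR _≼_ →
    (IsNMCR CR (N CR _≼_) × (∀ α β → (N CR _≼_ α β → MaxInf CR _≼_ α β) × (MaxInf CR _≼_ α β → N CR _≼_ α β)))
    × (BoundedCut CR _≼_ → CutRule CR (MaxInf CR _≼_))
    × (BoundedRightMonotonicity CR _≼_ → CautiousMonotonicity CR (MaxInf CR _≼_))
    × (Acyclicity CR _≼_ → LoopRule CR (MaxInf CR _≼_))
    × (RightConjunction CR _≼_ → OrRule CR (MaxInf CR _≼_))
mainTheorem13 em zorn Atom CR _≼_ isE ld =
    (N-isNMCR ld , λ _ _ → to , from)
  , (λ bc α|~β α∧β|~γ → to (N-cut bc (from α|~β) (from α∧β|~γ)))
  , (λ brm α|~β α|~γ → to (N-cautiousMonotonicity brm (from α|~β) (from α|~γ)))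
  , (λ ac m a steps back → to (N-loop ac m a (λ i i<n → from (steps i i<n)) (from back)))
  , (λ rc α|~γ β|~γ → to (N-or rc (from α|~γ) (from β|~γ)))
  where
    open Entrenchment CR _≼_ isE
    to : ∀ {α β} → N CR _≼_ α β → MaxInf CR _≼_ α β
    to = N⇒MaxInf em ld
    from : ∀ {α β} → MaxInf CR _≼_ α β → N CR _≼_ α β
    from = MaxInf⇒N em zorn
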